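{- Let $G$ be a graph rooted at $r$. Let $G_1,\dots,G_m$ be connected subgraphs of $G$, each containing $r$ and rooted at $r$, and for each $i$ let $w_i$ be a valid weight function on $G_i$ rooted at $r$, extended to all of $V(G)$ by setting $w_i(v)=0$ for $v\in V(G)\setminus V(G_i)$. Let $a_1,\dots,a_m\ge 0$ be real numbers and let $w=\sum_{i=1}^m a_i w_i$ be a weight function on $G$ such that $w(v)>0$ for every $v\ne r$. Then $w$ is a valid weight function on $G$ rooted at $r$.
   Context: A configuration on a graph $G$ is a function $p:V(G)\to\mathbb{N}\cup\{0\}$ ($p(v)$ is the number of pebbles on $v$). A pebbling move from a vertex $u$ to an adjacent vertex $v$ removes two pebbles from $u$ and places one pebble on $v$. For a root $r$, a configuration $p$ is $r$-solvable if some (possibly empty) sequence of pebbling moves starting from $p$ places at least one pebble on $r$; otherwise it is $r$-unsolvable. A weight function is a function $w:V(G)\to\mathbb{R}_{\ge 0}$, and the weight of a configuration is $w(p)=\sum_{v\in V(G)}p(v)w(v)$. $1_G$ denotes the configuration with exactly one pebble on every vertex of $G$, so $w(1_G)=\sum_{v\in V(G)}w(v)$. A weight function $w$ on $G$ rooted at $r$ is valid if $r$ is the only vertex with weight $0$ and every $r$-unsolvable configuration $p$ (on $G$) satisfies $w(p)\le w(1_G)$. -}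

module Defs where

open import Level using (Level; _⊔_) renaming (suc to lsuc)
open import Data.Nat using (ℕ; zero; suc; _∸_) renaming (_≤_ to _≤ℕ_)
open import Data.Fin using (Fin; zero; suc)
open import Data.Fin.Subset using (Subset; _∈_; _∉_; _⊆_)
open import Data.Fin.Subset.Properties using (_∈?_)
open import Data.Product using (Σ; ∃; _×_; _,_)
open import Relation.Nullary using (¬_; yes; no)
open import Relation.Binary using (Rel; IsTotalOrder)
open import Relation.Binary.PropositionalEquality using (_≡_; _≢_)
open import Relation.Binary.Construct.Closure.ReflexiveTransitive using (Star)
open import Algebra.Bundles using (CommutativeRing)

-- Ordered fields (stand-in for ℝ, which agda-stdlib lacks).
-- Every theorem proved for all ordered fields holds for ℝ in particular.

record OrderedField (c ℓ₁ ℓ₂ : Level) : Set (lsuc (c ⊔ ℓ₁ ⊔ ℓ₂)) where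
  field
    commutativeRing : CommutativeRing c ℓ₁
  open CommutativeRing commutativeRing public
  infix 4 _≤_
  field
    _≤_          : Rel Carrier ℓ₂
    isTotalOrder : IsTotalOrder _≈_ _≤_
    +-monoˡ-≤    : ∀ {x y} z → x ≤ y → (x + z) ≤ (y + z)
    *-nonneg     : ∀ {x y} → 0# ≤ x → 0# ≤ y → 0# ≤ (x * y)
    0≉1          : ¬ (0# ≈ 1#)
    inverse      : ∀ x → ¬ (x ≈ 0#) → ∃ λ y → (x * y) ≈ 1#

  infix 4 _<_
  _<_ : Rel Carrier (ℓ₁ ⊔ ℓ₂)
  x < y = (x ≤ y) × ¬ (x ≈ y)

-- Finite simple graphs whose vertex set is a subset V of Fin n.
-- (A subgraph of G is then a graph on a subset of the same Fin n.)

record Graph (n : ℕ) : Set₁ where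
  field
    V        : Subset n
    _~_      : Fin n → Fin n → Set
    ~-sym    : ∀ {u v} → u ~ v → v ~ u
    ~-irrefl : ∀ {u} → ¬ (u ~ u)
    ~-inV    : ∀ {u v} → u ~ v → (u ∈ V) × (v ∈ V)

open Graph public

Subgraph : ∀ {n} → Graph n → Graph n → Set
Subgraph H G = (V H ⊆ V G) × (∀ {u v} → _~_ H u v → _~_ G u v)

Connected : ∀ {n} → Graph n → Set
Connected H = ∀ {u v} → u ∈ V H → v ∈ V H → Star (_~_ H) u v

Config : ℕ → Set
Config n = Fin n → ℕ

OnGraph : ∀ {n} → Graph n → Config n → Set
OnGraph G p = ∀ v → v ∉ V G → p v ≡ 0

data Move {n} (G : Graph n) (p q : Config n) : Set where
  move : ∀ u v → _~_ G u v → 2 ≤ℕ p u →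
         q u ≡ p u ∸ 2 → q v ≡ suc (p v) →
         (∀ x → x ≢ u → x ≢ v → q x ≡ p x) → Move G p q

Solvable : ∀ {n} → Graph n → Fin n → Config n → Set
Solvable G r p = ∃ λ q → Star (Move G) p q × (1 ≤ℕ q r)

one : ∀ {n} → Graph n → Config n
one G v with v ∈? V G
... | yes _ = 1
... | no  _ = 0

module WithField {c ℓ₁ ℓ₂} (F : OrderedField c ℓ₁ ℓ₂) where
  open OrderedField F using (Carrier; _≈_; _≤_; _+_; 0#)

  Σ[_] : ∀ k → (Fin k → Carrier) → Carrier
  Σ[ zero ] f = 0#
  Σ[ suc k ] f = f zero + Σ[ k ] (λ i → f (suc i))

  _·_ : ℕ → Carrier → Carrier
  zero · x = 0#
  suc k · x = x + (k · x)

  weight : ∀ {n} → (Fin n → Carrier) → Config n → Carrier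
  weight {n} w p = Σ[ n ] (λ v → p v · w v)

  -- valid weight function on G rooted at r (only its values on V(G) matter)
  Valid : ∀ {n} → Graph n → Fin n → (Fin n → Carrier) → Set (ℓ₁ ⊔ ℓ₂)
  Valid G r w =
      (∀ v → v ∈ V G → 0# ≤ w v)
    × (w r ≈ 0#)
    × (∀ v → v ∈ V G → w v ≈ 0# → v ≡ r)
    × (∀ p → OnGraph G p → ¬ Solvable G r p → weight w p ≤ weight w (one G))

{-# OPTIONS --safe #-}
-- A move made by the restriction of p to V(Gᵢ) inside Gᵢ can be made in G from p
-- itself, the surplus pebbles just being carried along; so if p is r-unsolvable in G,
-- its restriction is r-unsolvable in Gᵢ, and validity of wᵢ gives
-- wᵢ(p) = wᵢ(p|Gᵢ) ≤ wᵢ(1_{Gᵢ}) = wᵢ(1_G). As w(p) = Σ aᵢ wᵢ(p) with aᵢ ≥ 0, these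
-- bounds add up to w(p) ≤ w(1_G); the remaining conditions of validity are pointwise.
module Submission where

open import Defs
open import Data.Nat using (ℕ)
open import Data.Fin using (Fin)
open import Data.Fin.Subset using (_∈_; _∉_)
open import Relation.Binary.PropositionalEquality using (_≢_)

open import Data.Nat using (zero; suc)
open import Data.Fin using (zero; suc; _≟_)
open import Data.Fin.Subset.Properties using (_∈?_)
open import Data.Product using (∃; _×_; _,_; proj₁; proj₂)
open import Data.Empty using (⊥-elim)
open import Function using (_∘′_)
open import Relation.Nullary using (¬_; yes; no)
open import Relation.Binary.PropositionalEquality using (_≡_)
open import Relation.Binary.Construct.Closure.ReflexiveTransitive using (Star; ε; _◅_)
open import Relation.Binary using (IsTotalOrder)
open import Relation.Binary.Bundles using (Poset)
import Relation.Binary.Reasoning.PartialOrder as PosetReasoning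
import Relation.Binary.Reasoning.Setoid as SetoidReasoning
import Algebra.Properties.CommutativeSemigroup as CommutativeSemigroupProperties

module Pebbling {n : ℕ} where
  open import Data.Nat using (_+_; _∸_; z≤n) renaming (_≤_ to _≤ℕ_)
  open import Data.Nat.Properties using (≤-refl; ≤-trans; m≤m+n; m+[n∸m]≡n; +-∸-comm)
  open import Relation.Binary.PropositionalEquality using (refl; sym; trans; cong)

  infix 4 _≤ᶜ_
  _≤ᶜ_ : Config n → Config n → Set
  p ≤ᶜ p′ = ∀ x → p x ≤ℕ p′ x

  ∸2+surplus≡∸2 : ∀ {a b} → 2 ≤ℕ a → a ≤ℕ b → (a ∸ 2) + (b ∸ a) ≡ b ∸ 2
  ∸2+surplus≡∸2 {a} {b} 2≤a a≤b =
    trans (sym (+-∸-comm (b ∸ a) 2≤a)) (cong (_∸ 2) (m+[n∸m]≡n a≤b))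

  -- The move from p′ leads to q + (p′ ∸ p): the surplus is left untouched.
  move-mono : ∀ {H G : Graph n} → (∀ {u v} → _~_ H u v → _~_ G u v) →
              ∀ {p q p′} → Move H p q → p ≤ᶜ p′ →
              ∃ λ q′ → Move G p′ q′ × q ≤ᶜ q′
  move-mono H⊆G {p} {q} {p′} (move u v u~v 2≤pu qu qv qx) p≤p′ =
    q′ , move u v (H⊆G u~v) (≤-trans 2≤pu (p≤p′ u)) q′u q′v q′x , λ x → m≤m+n (q x) _
    where
    q′ : Config n
    q′ x = q x + (p′ x ∸ p x)
    surplus : ∀ x → p x + (p′ x ∸ p x) ≡ p′ x
    surplus x = m+[n∸m]≡n (p≤p′ x)
    q′u : q′ u ≡ p′ u ∸ 2
    q′u = trans (cong (_+ (p′ u ∸ p u)) qu) (∸2+surplus≡∸2 2≤pu (p≤p′ u))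
    q′v : q′ v ≡ suc (p′ v)
    q′v = trans (cong (_+ (p′ v ∸ p v)) qv) (cong suc (surplus v))
    q′x : ∀ x → x ≢ u → x ≢ v → q′ x ≡ p′ x
    q′x x x≢u x≢v = trans (cong (_+ (p′ x ∸ p x)) (qx x x≢u x≢v)) (surplus x)

  moves-mono : ∀ {H G : Graph n} → (∀ {u v} → _~_ H u v → _~_ G u v) →
               ∀ {p q p′} → Star (Move H) p q → p ≤ᶜ p′ →
               ∃ λ q′ → Star (Move G) p′ q′ × q ≤ᶜ q′
  moves-mono H⊆G ε p≤p′ = _ , ε , p≤p′
  moves-mono H⊆G (m ◅ ms) p≤p′ with move-mono H⊆G m p≤p′
  ... | _ , m′ , q≤q′ with moves-mono H⊆G ms q≤q′
  ... | _ , ms′ , s≤s′ = _ , m′ ◅ ms′ , s≤s′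

  solvable-mono : ∀ {H G : Graph n} → (∀ {u v} → _~_ H u v → _~_ G u v) →
                  ∀ r {p p′} → p ≤ᶜ p′ → Solvable H r p → Solvable G r p′
  solvable-mono H⊆G r p≤p′ (q , ms , 1≤qr) with moves-mono H⊆G ms p≤p′
  ... | q′ , ms′ , q≤q′ = q′ , ms′ , ≤-trans 1≤qr (q≤q′ r)

  restrict : Graph n → Config n → Config n
  restrict H p x with x ∈? V H
  ... | yes _ = p x
  ... | no  _ = 0

  restrict-≤ᶜ : ∀ H p → restrict H p ≤ᶜ p
  restrict-≤ᶜ H p x with x ∈? V H
  ... | yes _ = ≤-refl
  ... | no  _ = z≤n

  restrict-onGraph : ∀ H p → OnGraph H (restrict H p)
  restrict-onGraph H p x x∉H with x ∈? V H
  ... | yes x∈H = ⊥-elim (x∉H x∈H)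
  ... | no  _   = refl

module Weights {c ℓ₁ ℓ₂} (F : OrderedField c ℓ₁ ℓ₂) where
  open OrderedField F hiding (zero)
  open WithField F
  open Pebbling

  poset : Poset c ℓ₁ ℓ₂
  poset = record { isPartialOrder = IsTotalOrder.isPartialOrder isTotalOrder }

  open Poset poset using () renaming (refl to ≤-refl; reflexive to ≤-reflexive; trans to ≤-trans)
  open CommutativeSemigroupProperties +-commutativeSemigroup using (interchange)

  +-mono-≤ : ∀ {x y u v} → x ≤ y → u ≤ v → x + u ≤ y + v
  +-mono-≤ {x} {y} {u} {v} x≤y u≤v = begin
    x + u ≤⟨ +-monoˡ-≤ u x≤y ⟩
    y + u ≈⟨ +-comm y u ⟩
    u + y ≤⟨ +-monoˡ-≤ y u≤v ⟩
    v + y ≈⟨ +-comm v y ⟩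
    y + v ∎
    where open PosetReasoning poset

  *-monoˡ-≤-nonneg : ∀ {a x y} → 0# ≤ a → x ≤ y → a * x ≤ a * y
  *-monoˡ-≤-nonneg {a} {x} {y} 0≤a x≤y = begin
    a * x                 ≈⟨ +-identityˡ (a * x) ⟨
    0# + a * x            ≤⟨ +-monoˡ-≤ (a * x) (*-nonneg 0≤a 0≤y-x) ⟩
    a * (y - x) + a * x   ≈⟨ distribˡ a (y - x) x ⟨
    a * ((y - x) + x)     ≈⟨ *-congˡ (+-assoc y (- x) x) ⟩
    a * (y + (- x + x))   ≈⟨ *-congˡ (+-congˡ (-‿inverseˡ x)) ⟩
    a * (y + 0#)          ≈⟨ *-congˡ (+-identityʳ y) ⟩
    a * y                 ∎
    where
    open PosetReasoning poset
    0≤y-x : 0# ≤ y - x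
    0≤y-x = ≤-trans (≤-reflexive (sym (-‿inverseʳ x))) (+-monoˡ-≤ (- x) x≤y)

  Σ-cong : ∀ k {f g : Fin k → Carrier} → (∀ i → f i ≈ g i) → Σ[ k ] f ≈ Σ[ k ] g
  Σ-cong zero    f≈g = refl
  Σ-cong (suc k) f≈g = +-cong (f≈g zero) (Σ-cong k (λ i → f≈g (suc i)))

  Σ-mono-≤ : ∀ k {f g : Fin k → Carrier} → (∀ i → f i ≤ g i) → Σ[ k ] f ≤ Σ[ k ] g
  Σ-mono-≤ zero    f≤g = ≤-refl
  Σ-mono-≤ (suc k) f≤g = +-mono-≤ (f≤g zero) (Σ-mono-≤ k (λ i → f≤g (suc i)))

  Σ-zero : ∀ k {f : Fin k → Carrier} → (∀ i → f i ≈ 0#) → Σ[ k ] f ≈ 0#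
  Σ-zero zero    f≈0 = refl
  Σ-zero (suc k) f≈0 = trans (+-cong (f≈0 zero) (Σ-zero k (λ i → f≈0 (suc i)))) (+-identityˡ 0#)

  Σ-nonneg : ∀ k {f : Fin k → Carrier} → (∀ i → 0# ≤ f i) → 0# ≤ Σ[ k ] f
  Σ-nonneg k 0≤f = ≤-trans (≤-reflexive (sym (Σ-zero k {λ _ → 0#} (λ _ → refl)))) (Σ-mono-≤ k 0≤f)

  Σ-distrib-+ : ∀ k (f g : Fin k → Carrier) → Σ[ k ] (λ i → f i + g i) ≈ Σ[ k ] f + Σ[ k ] g
  Σ-distrib-+ zero    f g = sym (+-identityˡ 0#)
  Σ-distrib-+ (suc k) f g = trans (+-congˡ (Σ-distrib-+ k _ _)) (interchange _ _ _ _)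

  Σ-*ˡ : ∀ k a (f : Fin k → Carrier) → Σ[ k ] (λ i → a * f i) ≈ a * Σ[ k ] f
  Σ-*ˡ zero    a f = sym (zeroʳ a)
  Σ-*ˡ (suc k) a f = trans (+-congˡ (Σ-*ˡ k a _)) (sym (distribˡ a _ _))

  Σ-comm : ∀ k m (f : Fin k → Fin m → Carrier) →
           Σ[ k ] (λ v → Σ[ m ] (f v)) ≈ Σ[ m ] (λ i → Σ[ k ] (λ v → f v i))
  Σ-comm zero    m f = sym (Σ-zero m (λ _ → refl))
  Σ-comm (suc k) m f = trans (+-congˡ (Σ-comm k m _)) (sym (Σ-distrib-+ m _ _))

  ·-zero : ∀ k {x} → x ≈ 0# → k · x ≈ 0#
  ·-zero zero    x≈0 = refl
  ·-zero (suc k) x≈0 = trans (+-cong x≈0 (·-zero k x≈0)) (+-identityˡ 0#)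

  ·-distrib-Σ : ∀ k m (f : Fin m → Carrier) → k · Σ[ m ] f ≈ Σ[ m ] (λ i → k · f i)
  ·-distrib-Σ zero    m f = sym (Σ-zero m (λ _ → refl))
  ·-distrib-Σ (suc k) m f = trans (+-congˡ (·-distrib-Σ k m f)) (sym (Σ-distrib-+ m _ _))

  ·-*-comm : ∀ k a x → k · (a * x) ≈ a * (k · x)
  ·-*-comm zero    a x = sym (zeroʳ a)
  ·-*-comm (suc k) a x = trans (+-congˡ (·-*-comm k a x)) (sym (distribˡ a _ _))

  combination : ∀ {n m} → (Fin m → Carrier) → (Fin m → Fin n → Carrier) → Fin n → Carrier
  combination {m = m} a ws v = Σ[ m ] (λ i → a i * ws i v)

  weight-combination : ∀ {n m} a (ws : Fin m → Fin n → Carrier) p →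
    weight (combination a ws) p ≈ Σ[ m ] (λ i → a i * weight (ws i) p)
  weight-combination {n} {m} a ws p = begin
    Σ[ n ] (λ v → p v · Σ[ m ] (λ i → a i * ws i v))
      ≈⟨ Σ-cong n (λ v → ·-distrib-Σ (p v) m _) ⟩
    Σ[ n ] (λ v → Σ[ m ] (λ i → p v · (a i * ws i v)))
      ≈⟨ Σ-cong n (λ v → Σ-cong m (λ i → ·-*-comm (p v) (a i) (ws i v))) ⟩
    Σ[ n ] (λ v → Σ[ m ] (λ i → a i * (p v · ws i v)))
      ≈⟨ Σ-comm n m _ ⟩
    Σ[ m ] (λ i → Σ[ n ] (λ v → a i * (p v · ws i v)))
      ≈⟨ Σ-cong m (λ i → Σ-*ˡ n (a i) _) ⟩
    Σ[ m ] (λ i → a i * weight (ws i) p) ∎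
    where open SetoidReasoning setoid

  VanishesOutside : ∀ {n} → Graph n → (Fin n → Carrier) → Set ℓ₁
  VanishesOutside H w = ∀ v → v ∉ V H → w v ≈ 0#

  weight-restrict : ∀ {n} (H : Graph n) {w} → VanishesOutside H w →
                    ∀ p → weight w (restrict H p) ≈ weight w p
  weight-restrict {n} H w≈0 p = Σ-cong n term
    where
    term : ∀ x → restrict H p x · _ ≈ p x · _
    term x with x ∈? V H
    ... | yes _   = refl
    ... | no  x∉H = sym (·-zero (p x) (w≈0 x x∉H))

  weight-one-subgraph : ∀ {n} {H G : Graph n} → Subgraph H G → ∀ {w} → VanishesOutside H w →
                        weight w (one H) ≈ weight w (one G)
  weight-one-subgraph {n} {H} {G} (VH⊆VG , _) w≈0 = Σ-cong n term
    where
    term : ∀ x → one H x · _ ≈ one G x · _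
    term x with x ∈? V H | x ∈? V G
    ... | yes _   | yes _   = refl
    ... | yes x∈H | no  x∉G = ⊥-elim (x∉G (VH⊆VG x∈H))
    ... | no  x∉H | yes _   = sym (·-zero 1 (w≈0 x x∉H))
    ... | no  _   | no  _   = refl

  valid⇒nonneg : ∀ {n} {H : Graph n} {r w} → VanishesOutside H w → Valid H r w → ∀ v → 0# ≤ w v
  valid⇒nonneg {H = H} w≈0 (0≤w , _) v with v ∈? V H
  ... | yes v∈H = 0≤w v v∈H
  ... | no  v∉H = ≤-reflexive (sym (w≈0 v v∉H))

  BoundsUnsolvable : ∀ {n} → Graph n → Fin n → (Fin n → Carrier) → Set ℓ₂
  BoundsUnsolvable G r w = ∀ p → ¬ Solvable G r p → weight w p ≤ weight w (one G)

  valid⇒boundsUnsolvable-supergraph :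
    ∀ {n} {H G : Graph n} {r w} → Subgraph H G → VanishesOutside H w →
    Valid H r w → BoundsUnsolvable G r w
  valid⇒boundsUnsolvable-supergraph {H = H} {G} {r} {w} H⊆G w≈0 (_ , _ , _ , bound) p p-unsolvable =
    begin
      weight w p               ≈⟨ weight-restrict H w≈0 p ⟨
      weight w (restrict H p)  ≤⟨ bound (restrict H p) (restrict-onGraph H p) restriction-unsolvable ⟩
      weight w (one H)         ≈⟨ weight-one-subgraph H⊆G w≈0 ⟩
      weight w (one G)         ∎
    where
    open PosetReasoning poset
    restriction-unsolvable : ¬ Solvable H r (restrict H p)
    restriction-unsolvable = p-unsolvable ∘′ solvable-mono (proj₂ H⊆G) r (restrict-≤ᶜ H p)

  boundsUnsolvable-combination :
    ∀ {n m} {G : Graph n} {r} a (ws : Fin m → Fin n → Carrier) → (∀ i → 0# ≤ a i) →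
    (∀ i → BoundsUnsolvable G r (ws i)) → BoundsUnsolvable G r (combination a ws)
  boundsUnsolvable-combination {m = m} {G} a ws 0≤a bounds p p-unsolvable = begin
    weight (combination a ws) p
      ≈⟨ weight-combination a ws p ⟩
    Σ[ m ] (λ i → a i * weight (ws i) p)
      ≤⟨ Σ-mono-≤ m (λ i → *-monoˡ-≤-nonneg (0≤a i) (bounds i p p-unsolvable)) ⟩
    Σ[ m ] (λ i → a i * weight (ws i) (one G))
      ≈⟨ weight-combination a ws (one G) ⟨
    weight (combination a ws) (one G) ∎
    where open PosetReasoning poset

lemma4 : ∀ {c ℓ₁ ℓ₂} (F : OrderedField c ℓ₁ ℓ₂) →
    let open OrderedField F
        open WithField F
    in ∀ {n} (G : Graph n) (r : Fin n) → r ∈ V G →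
    (m : ℕ) (Gs : Fin m → Graph n) →
    (∀ i → Subgraph (Gs i) G) → (∀ i → Connected (Gs i)) → (∀ i → r ∈ V (Gs i)) →
    (ws : Fin m → Fin n → Carrier) →
    (∀ i → Valid (Gs i) r (ws i)) →
    (∀ i v → v ∉ V (Gs i) → ws i v ≈ 0#) →
    (a : Fin m → Carrier) → (∀ i → 0# ≤ a i) →
    (∀ v → v ∈ V G → v ≢ r → 0# < Σ[ m ] (λ i → a i * ws i v)) →
    Valid G r (λ v → Σ[ m ] (λ i → a i * ws i v))
lemma4 F G r _ m Gs Gs⊆G _ _ ws valid ws≈0 a 0≤a 0<w =
  nonneg , root-zero , only-root-zero , bounds
  where
  open OrderedField F hiding (zero)
  open WithField F
  open Weights F
  nonneg : ∀ v → v ∈ V G → 0# ≤ combination a ws v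
  nonneg v _ = Σ-nonneg m (λ i → *-nonneg (0≤a i) (valid⇒nonneg (ws≈0 i) (valid i) v))
  root-zero : combination a ws r ≈ 0#
  root-zero = Σ-zero m (λ i → trans (*-congˡ (proj₁ (proj₂ (valid i)))) (zeroʳ (a i)))
  only-root-zero : ∀ v → v ∈ V G → combination a ws v ≈ 0# → v ≡ r
  only-root-zero v v∈G w≈0 with v ≟ r
  ... | yes v≡r = v≡r
  ... | no  v≢r = ⊥-elim (proj₂ (0<w v v∈G v≢r) (sym w≈0))
  bounds : ∀ p → OnGraph G p → ¬ Solvable G r p →
           weight (combination a ws) p ≤ weight (combination a ws) (one G)
  bounds p _ = boundsUnsolvable-combination a ws 0≤a
    (λ i → valid⇒boundsUnsolvable-supergraph (Gs⊆G i) (ws≈0 i) (valid i)) p
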